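{- Let $\Omega$ be a fixed closed Riemann surface of positive genus $g>0$. Then for every $n>0$ there is a triangulation $T$ of $\Omega$ with $n \leq |V(T)|$ such that $T$ has a non-degenerated antiferromagnetic groundstate.
   Context: A triangulation of a closed Riemann surface $\Omega$ is an embedding of a graph in $\Omega$ such that each face boundary is a $3$-cycle of the graph. A state (spin-assignment) on a triangulation $T$ is a function $\sigma: V(T)\to\{+1,-1\}$. The antiferromagnetic Ising energy of $\sigma$ is $H(\sigma)=\sum_{uv\in E(T)}\sigma_u\sigma_v$. A groundstate is a state minimizing $H$. Since $H(\sigma)=H(-\sigma)$, groundstates come in pairs $\{\sigma,-\sigma\}$; the groundstate is called non-degenerated if $T$ has exactly two groundstates (i.e. exactly one pair $\sigma,-\sigma$), and degenerated if it has more than two. -}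

module Defs where

open import Data.Nat using (ℕ; _+_; _*_; _<ᵇ_)
open import Data.Fin using (Fin; toℕ)
open import Data.Fin.Subset using (Subset; _∈_)
open import Data.Bool using (Bool; true; false; if_then_else_; not)
open import Data.Integer as ℤ using (ℤ; 0ℤ; 1ℤ; -1ℤ)
open import Data.List using (List; []; _∷_; concatMap; length; foldr; map)
import Data.List.Membership.Propositional as LM
open import Data.List.Relation.Unary.Unique.Propositional using (Unique)
open import Data.Product using (_×_; _,_; ∃; Σ)
open import Data.Sum using (_⊎_)
open import Relation.Binary.PropositionalEquality using (_≡_; _≢_)

private
  _∈ˡ_ : ∀ {A : Set} → A → List A → Set
  _∈ˡ_ = LM._∈_

Triple : ℕ → Set
Triple n = Fin n × Fin n × Fin n

corners : ∀ {n} → Triple n → List (Triple n)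
corners (a , b , c) = (a , b , c) ∷ (b , c , a) ∷ (c , a , b) ∷ []

-- Directed boundary edges of all faces (each face boundary traversed
-- according to the orientation of the surface).
dirEdges : ∀ {n} → List (Triple n) → List (Fin n × Fin n)
dirEdges = concatMap (λ { (a , b , c) → (a , b) ∷ (b , c) ∷ (c , a) ∷ [] })

-- Combinatorial description of a triangulation of the closed orientable
-- surface of genus g with vertex set Fin n and (oriented) face list F.
-- The graph is: uv an edge iff (u , v) occurs in dirEdges F.
record IsTriangulation {n : ℕ} (F : List (Triple n)) (g : ℕ) : Set where
  field
    faceDistinct : ∀ {a b c} → (a , b , c) ∈ˡ F → (a ≢ b) × (b ≢ c) × (c ≢ a)
    -- every directed edge lies on exactly one face ...
    dirUnique    : Unique (dirEdges F)
    -- ... and every edge is on two faces, with opposite orientations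
    reverse      : ∀ {u v} → (u , v) ∈ˡ dirEdges F → (v , u) ∈ˡ dirEdges F
    noIsolated   : ∀ v → ∃ λ u → (v , u) ∈ˡ dirEdges F
    connected    : ∀ (S : Subset n) → (∃ λ v → v ∈ S)
                   → (∀ {u v} → (u , v) ∈ˡ dirEdges F → u ∈ S → v ∈ S)
                   → ∀ v → v ∈ S
    -- manifold condition: the link of every vertex v (neighbours of v,
    -- a ↦ b whenever (v , a , b) is a corner of a face) is a single cycle
    linkCycle    : ∀ v (S : Subset n)
                   → (∃ λ a → ((v , a) ∈ˡ dirEdges F) × (a ∈ S))
                   → (∀ {a b} → (v , a , b) ∈ˡ concatMap corners F → a ∈ S → b ∈ S)
                   → ∀ a → (v , a) ∈ˡ dirEdges F → a ∈ S
    -- Euler's formula V - E + F = 2 - 2g, with E = |dirEdges| / 2,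
    -- multiplied by 2 and rearranged to live in ℕ
    euler        : 2 * n + 2 * length F + 4 * g ≡ length (dirEdges F) + 4

State : ℕ → Set
State n = Fin n → Bool

spin : Bool → ℤ
spin true  = 1ℤ
spin false = -1ℤ

-- Antiferromagnetic Ising energy: sum over undirected edges uv of σu σv.
-- Each undirected edge {u,v} is counted once, via its orientation with u < v.
energy : ∀ {n} → List (Triple n) → State n → ℤ
energy F σ = foldr ℤ._+_ 0ℤ (map term (dirEdges F))
  where
  term : _ → ℤ
  term (u , v) = if toℕ u <ᵇ toℕ v then spin (σ u) ℤ.* spin (σ v) else 0ℤ

IsGroundstate : ∀ {n} → List (Triple n) → State n → Set
IsGroundstate F σ = ∀ τ → energy F σ ℤ.≤ energy F τ

-- Exactly two groundstates: some groundstate σ, and every groundstate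
-- is σ or -σ.
NonDegenerate : ∀ {n} → List (Triple n) → Set
NonDegenerate {n} F =
  Σ (State n) λ σ → IsGroundstate F σ ×
    (∀ τ → IsGroundstate F τ → (∀ v → τ v ≡ σ v) ⊎ (∀ v → τ v ≡ not (σ v)))

module Submission where

-- Summing σu σv over the three edges of a face gives 3 if the face is monochromatic and -1
-- otherwise, and every edge lies on two faces, so 2 H(σ) + |F| = 4 · #(monochromatic faces).
-- Hence, as soon as a triangulation admits a proper 2-colouring (one without monochromatic
-- faces), its groundstates are exactly its proper colourings, and the groundstate is
-- non-degenerated iff the proper colouring is unique up to flipping all spins.
-- Such triangulations are built by surgery.  Start from a torus with a unique proper colouring
-- in which a marked face is coloured s, not s, s.  Gluing into the marked face a patch whose
-- colouring is forced by its boundary preserves this property; a handle patch raises the genus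
-- by one and a stellar subdivision adds one vertex.  The three finite patches, the torus and
-- the uniqueness of their colourings are verified by computation.

open import Defs
import Algebra.Properties.CommutativeSemigroup as CommutativeSemigroupProperties
open import Data.Bool using (Bool; true; false; not; _∧_; _xor_; if_then_else_)
open import Data.Bool.Properties as BoolP
  using (not-involutive; not-distribʳ-xor; xor-same; xor-assoc; xor-comm; xor-identityʳ)
open import Data.Empty using (⊥; ⊥-elim)
open import Data.Fin as Fin using (Fin; toℕ; zero; suc; #_; _↑ˡ_; _↑ʳ_)
import Data.Fin.Properties as FinP
open import Data.Fin.Subset using (Subset) renaming (_∈_ to _∈ₛ_)
open import Data.Integer using (ℤ)
import Data.Integer.Properties as ℤP
import Data.Integer.Tactic.RingSolver as ℤ-Solver
open import Data.List using (List; []; _∷_; map; foldr; length; _++_; concatMap)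
import Data.List.Properties as ListP
open import Data.List.Membership.Propositional using (_∈_; _∉_)
open import Data.List.Membership.Propositional.Properties using (∈-map⁺; ∈-map⁻; ∈-++⁺ˡ; ∈-++⁺ʳ; ∈-++⁻)
open import Data.List.Membership.Propositional.Properties.WithK using (unique∧set⇒bag)
import Data.List.Membership.DecPropositional as DecMembership
open import Data.List.Relation.Binary.BagAndSetEquality using (∼bag⇒↭)
open import Data.List.Relation.Binary.Permutation.Propositional using (_↭_; ↭⇒↭ₛ)
import Data.List.Relation.Binary.Permutation.Propositional.Properties as ↭
import Data.List.Relation.Binary.Permutation.Setoid.Properties as ↭ₛ
open import Data.List.Relation.Unary.All as All using (All; []; _∷_)
import Data.List.Relation.Unary.All.Properties as All
open import Data.List.Relation.Unary.Any using (here; there)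
open import Data.List.Relation.Unary.Unique.Propositional using (Unique; _∷_)
import Data.List.Relation.Unary.Unique.Propositional.Properties as Unique
import Data.List.Relation.Unary.Unique.DecPropositional as UniqueDec
open import Data.Nat as ℕ using (ℕ; zero; suc; _<ᵇ_; z≤n; s≤s)
import Data.Nat.Properties as ℕP
import Data.Nat.Tactic.RingSolver as ℕ-Solver
open import Data.Product using (Σ; ∃; _×_; _,_; proj₁; proj₂)
open import Data.Product.Properties using (≡-dec; ,-injective; ,-injectiveˡ; ,-injectiveʳ)
open import Data.Sum as Sum using (_⊎_; inj₁; inj₂; [_,_]′)
open import Data.Unit using (⊤; tt)
open import Data.Vec using (_∷_; []; tabulate; lookup)
import Data.Vec.Properties as VecP
import Data.Vec.Functional as Vector
open import Function using (_∘_)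
open import Function.Bundles using (mk⇔)
open import Relation.Nullary using (¬_; Dec; yes; no; ofʸ; ofⁿ)
open import Relation.Nullary.Decidable using (map′; from-yes; _×-dec_; _⊎-dec_; _→-dec_; ¬?)
open import Relation.Binary.PropositionalEquality

-- Proper colourings

Edge : ℕ → Set
Edge n = Fin n × Fin n

swap : ∀ {n} → Edge n → Edge n
swap (u , v) = v , u

sameColour : Bool → Bool → Bool
sameColour p q = not (p xor q)

monochromatic : ∀ {n} → State n → Triple n → Bool
monochromatic σ (x , y , z) = sameColour (σ x) (σ y) ∧ sameColour (σ y) (σ z)

Proper : ∀ {n} → State n → List (Triple n) → Set
Proper σ = All (λ t → monochromatic σ t ≡ false)

UpToFlip : ∀ {n} → State n → State n → Set
UpToFlip τ σ = (∀ v → τ v ≡ σ v) ⊎ (∀ v → τ v ≡ not (σ v))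

record UniqueProperColouring {n} (F : List (Triple n)) : Set where
  field
    colouring : State n
    proper    : Proper colouring F
    unique    : ∀ τ → Proper τ F → UpToFlip τ colouring

xor-cancelˡ : ∀ s x → s xor (s xor x) ≡ x
xor-cancelˡ s x = trans (sym (xor-assoc s s x)) (cong (_xor x) (xor-same s))

sameColour-xor : ∀ s p q → sameColour (s xor p) (s xor q) ≡ sameColour p q
sameColour-xor false p     q     = refl
sameColour-xor true  true  true  = refl
sameColour-xor true  true  false = refl
sameColour-xor true  false true  = refl
sameColour-xor true  false false = refl

monochromatic-xor : ∀ {n} s (σ : State n) t → monochromatic (λ v → s xor σ v) t ≡ monochromatic σ t
monochromatic-xor s σ (x , y , z) rewrite sameColour-xor s (σ x) (σ y) | sameColour-xor s (σ y) (σ z) = refl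

monochromatic-cong : ∀ {n} {σ τ : State n} → (∀ v → σ v ≡ τ v) → ∀ t → monochromatic σ t ≡ monochromatic τ t
monochromatic-cong σ≗τ (x , y , z) rewrite σ≗τ x | σ≗τ y | σ≗τ z = refl

Proper-xor : ∀ {n} s {σ : State n} {F} → Proper σ F → Proper (λ v → s xor σ v) F
Proper-xor s {σ} = All.map λ {t} → trans (monochromatic-xor s σ t)

Proper-cong : ∀ {n} {σ τ : State n} {F} → (∀ v → σ v ≡ τ v) → Proper σ F → Proper τ F
Proper-cong σ≗τ = All.map λ {t} → trans (sym (monochromatic-cong σ≗τ t))

module IsingEnergy where
  open Data.Integer using (+_; 0ℤ; 1ℤ; _+_; _*_; _≤_; _≤?_; +≤+)
  open CommutativeSemigroupProperties ℤP.+-commutativeSemigroup using (interchange)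

  sumℤ : {A : Set} → (A → ℤ) → List A → ℤ
  sumℤ f xs = foldr _+_ 0ℤ (map f xs)

  sumℤ-cong : ∀ {A : Set} {f g : A → ℤ} {xs} → All (λ x → f x ≡ g x) xs → sumℤ f xs ≡ sumℤ g xs
  sumℤ-cong []       = refl
  sumℤ-cong (e ∷ es) = cong₂ _+_ e (sumℤ-cong es)

  sumℤ-map : ∀ {A B : Set} (f : B → ℤ) (g : A → B) xs → sumℤ f (map g xs) ≡ sumℤ (f ∘ g) xs
  sumℤ-map f g []       = refl
  sumℤ-map f g (x ∷ xs) = cong (λ s → f (g x) + s) (sumℤ-map f g xs)

  sumℤ-+ : ∀ {A : Set} (f g : A → ℤ) xs → sumℤ f xs + sumℤ g xs ≡ sumℤ (λ x → f x + g x) xs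
  sumℤ-+ f g []       = refl
  sumℤ-+ f g (x ∷ xs) =
    trans (interchange (f x) (sumℤ f xs) (g x) (sumℤ g xs)) (cong (λ s → f x + g x + s) (sumℤ-+ f g xs))

  sumℤ-↭ : ∀ {A : Set} (f : A → ℤ) {xs ys} → xs ↭ ys → sumℤ f xs ≡ sumℤ f ys
  sumℤ-↭ f p = ↭ₛ.foldr-commMonoid (setoid ℤ) ℤP.+-0-isCommutativeMonoid (↭⇒↭ₛ (↭.map⁺ f p))

  spinProduct : ∀ {n} → State n → Edge n → ℤ
  spinProduct σ (u , v) = spin (σ u) * spin (σ v)

  orderedSpinProduct : ∀ {n} → State n → Edge n → ℤ
  orderedSpinProduct σ (u , v) = if toℕ u <ᵇ toℕ v then spinProduct σ (u , v) else 0ℤ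

  energy≡sumℤ : ∀ {n} (F : List (Triple n)) σ → energy F σ ≡ sumℤ (orderedSpinProduct σ) (dirEdges F)
  energy≡sumℤ F σ = sumℤ-cong (All.universal (λ _ → refl) (dirEdges F))

  orderedSpinProduct-+-swap : ∀ {n} (σ : State n) {u v} → u ≢ v →
    orderedSpinProduct σ (u , v) + orderedSpinProduct σ (v , u) ≡ spinProduct σ (u , v)
  orderedSpinProduct-+-swap σ {u} {v} u≢v
    with toℕ u <ᵇ toℕ v | ℕP.<ᵇ-reflects-< (toℕ u) (toℕ v)
       | toℕ v <ᵇ toℕ u | ℕP.<ᵇ-reflects-< (toℕ v) (toℕ u)
  ... | true  | ofʸ u<v | true  | ofʸ v<u = ⊥-elim (ℕP.<-asym u<v v<u)
  ... | true  | _       | false | _       = ℤP.+-identityʳ _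
  ... | false | _       | true  | _       = trans (ℤP.+-identityˡ _) (ℤP.*-comm (spin (σ v)) (spin (σ u)))
  ... | false | ofⁿ u≮v | false | ofⁿ v≮u =
    ⊥-elim (u≢v (FinP.toℕ-injective (ℕP.≤-antisym (ℕP.≮⇒≥ v≮u) (ℕP.≮⇒≥ u≮v))))

  monochromaticCount : ∀ {n} → State n → List (Triple n) → ℕ
  monochromaticCount σ []      = 0
  monochromaticCount σ (t ∷ F) = (if monochromatic σ t then 1 else 0) ℕ.+ monochromaticCount σ F

  face-spinProducts : ∀ p q r → spin p * spin q + (spin q * spin r + spin r * spin p) + 1ℤ
                                ≡ + (4 ℕ.* (if sameColour p q ∧ sameColour q r then 1 else 0))
  face-spinProducts true  true  true  = refl
  face-spinProducts true  true  false = refl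
  face-spinProducts true  false true  = refl
  face-spinProducts true  false false = refl
  face-spinProducts false true  true  = refl
  face-spinProducts false true  false = refl
  face-spinProducts false false true  = refl
  face-spinProducts false false false = refl

  sumℤ-spinProduct-dirEdges : ∀ {n} (σ : State n) F →
    sumℤ (spinProduct σ) (dirEdges F) + + length F ≡ + (4 ℕ.* monochromaticCount σ F)
  sumℤ-spinProduct-dirEdges σ [] = refl
  sumℤ-spinProduct-dirEdges σ ((x , y , z) ∷ F) = begin
    (A + (B + (C + S))) + (1ℤ + + length F)  ≡⟨ regroup A B C S (+ length F) ⟩
    (A + (B + C) + 1ℤ) + (S + + length F)    ≡⟨ cong₂ _+_ (face-spinProducts (σ x) (σ y) (σ z))
                                                           (sumℤ-spinProduct-dirEdges σ F) ⟩
    + (4 ℕ.* i ℕ.+ 4 ℕ.* monochromaticCount σ F) ≡⟨ cong +_ (ℕP.*-distribˡ-+ 4 i _) ⟨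
    + (4 ℕ.* monochromaticCount σ ((x , y , z) ∷ F)) ∎
    where
    open ≡-Reasoning
    A B C S : ℤ
    A = spin (σ x) * spin (σ y)
    B = spin (σ y) * spin (σ z)
    C = spin (σ z) * spin (σ x)
    S = sumℤ (spinProduct σ) (dirEdges F)
    i : ℕ
    i = if monochromatic σ (x , y , z) then 1 else 0
    regroup : ∀ a b c s l → (a + (b + (c + s))) + (1ℤ + l) ≡ (a + (b + c) + 1ℤ) + (s + l)
    regroup = ℤ-Solver.solve-∀

  dirEdges-irreflexive : ∀ {n} (F : List (Triple n)) →
    (∀ {a b c} → (a , b , c) ∈ F → (a ≢ b) × (b ≢ c) × (c ≢ a)) →
    ∀ {u v} → (u , v) ∈ dirEdges F → u ≢ v
  dirEdges-irreflexive (_ ∷ F) distinct (here refl)                 = proj₁ (distinct (here refl))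
  dirEdges-irreflexive (_ ∷ F) distinct (there (here refl))         = proj₁ (proj₂ (distinct (here refl)))
  dirEdges-irreflexive (_ ∷ F) distinct (there (there (here refl))) = proj₂ (proj₂ (distinct (here refl)))
  dirEdges-irreflexive (_ ∷ F) distinct (there (there (there p)))   = dirEdges-irreflexive F (distinct ∘ there) p

  ↭-map-swap : ∀ {n} {D : List (Edge n)} → Unique D → (∀ {u v} → (u , v) ∈ D → (v , u) ∈ D) → D ↭ map swap D
  ↭-map-swap {D = D} unique reverse =
    ∼bag⇒↭ (unique∧set⇒bag unique (Unique.map⁺ swap-injective unique) (mk⇔ to from))
    where
    swap-injective : ∀ {e e′} → swap e ≡ swap e′ → e ≡ e′
    swap-injective {_ , _} {_ , _} refl = refl
    to : ∀ {e} → e ∈ D → e ∈ map swap D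
    to {_ , _} e∈D = ∈-map⁺ swap (reverse e∈D)
    from : ∀ {e} → e ∈ map swap D → e ∈ D
    from e∈ with ∈-map⁻ swap e∈
    ... | (_ , _) , e′∈D , refl = reverse e′∈D

  -- The reversal symmetry of the edge list turns the sum over edges u < v into half the sum over
  -- all directed edges, which in turn is a sum over faces.
  twice-energy : ∀ {n} {F : List (Triple n)} {g} → IsTriangulation F g → ∀ σ →
    energy F σ + energy F σ + + length F ≡ + (4 ℕ.* monochromaticCount σ F)
  twice-energy {F = F} T σ = begin
    energy F σ + energy F σ + + length F           ≡⟨ cong (λ s → s + s + + length F) (energy≡sumℤ F σ) ⟩
    sumℤ w D + sumℤ w D + + length F               ≡⟨ cong (λ s → sumℤ w D + s + + length F) reversed ⟩
    sumℤ w D + sumℤ (w ∘ swap) D + + length F      ≡⟨ cong (_+ + length F) (sumℤ-+ w (w ∘ swap) D) ⟩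
    sumℤ (λ e → w e + w (swap e)) D + + length F   ≡⟨ cong (_+ + length F) (sumℤ-cong (All.tabulate pair)) ⟩
    sumℤ (spinProduct σ) D + + length F            ≡⟨ sumℤ-spinProduct-dirEdges σ F ⟩
    + (4 ℕ.* monochromaticCount σ F)               ∎
    where
    open ≡-Reasoning
    open IsTriangulation T
    w : Edge _ → ℤ
    w = orderedSpinProduct σ
    D : List (Edge _)
    D = dirEdges F
    reversed : sumℤ w D ≡ sumℤ (w ∘ swap) D
    reversed = trans (sumℤ-↭ w (↭-map-swap dirUnique reverse)) (sumℤ-map w swap D)
    pair : ∀ {e} → e ∈ D → w e + w (swap e) ≡ spinProduct σ e
    pair {_ , _} e∈D = orderedSpinProduct-+-swap σ (dirEdges-irreflexive F faceDistinct e∈D)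

  Proper⇒monochromaticCount≡0 : ∀ {n} (σ : State n) {F} → Proper σ F → monochromaticCount σ F ≡ 0
  Proper⇒monochromaticCount≡0 σ []                   = refl
  Proper⇒monochromaticCount≡0 σ (not-mono ∷ proper) rewrite not-mono = Proper⇒monochromaticCount≡0 σ proper

  monochromaticCount≡0⇒Proper : ∀ {n} (σ : State n) F → monochromaticCount σ F ≡ 0 → Proper σ F
  monochromaticCount≡0⇒Proper σ []      _ = []
  monochromaticCount≡0⇒Proper σ (t ∷ F) count≡0 with monochromatic σ t in not-mono
  ... | false = not-mono ∷ monochromaticCount≡0⇒Proper σ F count≡0

  double-cancel-≤ : ∀ x y l → x + x + l ≤ y + y + l → x ≤ y
  double-cancel-≤ x y l x+x+l≤y+y+l with x ≤? y
  ... | yes x≤y = x≤y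
  ... | no  x≰y = ⊥-elim (ℤP.<⇒≱ (ℤP.+-monoˡ-< l (ℤP.+-mono-< y<x y<x)) x+x+l≤y+y+l)
    where
    y<x : y Data.Integer.< x
    y<x = ℤP.≰⇒> x≰y

  module _ {n} {F : List (Triple n)} {g} (T : IsTriangulation F g) (σ : State n) (σ-proper : Proper σ F) where

    private
      twice-energy-σ : energy F σ + energy F σ + + length F ≡ 0ℤ
      twice-energy-σ = trans (twice-energy T σ) (cong (λ c → + (4 ℕ.* c)) (Proper⇒monochromaticCount≡0 σ σ-proper))

    Proper⇒IsGroundstate : IsGroundstate F σ
    Proper⇒IsGroundstate τ = double-cancel-≤ _ _ (+ length F)
      (subst₂ _≤_ (sym twice-energy-σ) (sym (twice-energy T τ)) (+≤+ ℕ.z≤n))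

    IsGroundstate⇒Proper : ∀ τ → IsGroundstate F τ → Proper τ F
    IsGroundstate⇒Proper τ τ-ground = monochromaticCount≡0⇒Proper τ F
      (ℕP.n≤0⇒n≡0 (ℕP.≤-trans (ℕP.m≤n*m _ 4) (ℤP.drop‿+≤+ 4·count≤0)))
      where
      4·count≤0 : + (4 ℕ.* monochromaticCount τ F) ≤ 0ℤ
      4·count≤0 = subst₂ _≤_ (twice-energy T τ) twice-energy-σ
        (ℤP.+-monoˡ-≤ (+ length F) (ℤP.+-mono-≤ (τ-ground σ) (τ-ground σ)))

  UniqueProperColouring⇒NonDegenerate : ∀ {n} {F : List (Triple n)} {g} → IsTriangulation F g →
    UniqueProperColouring F → NonDegenerate F
  UniqueProperColouring⇒NonDegenerate T χ =
    colouring , Proper⇒IsGroundstate T colouring proper ,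
    λ τ τ-ground → unique τ (IsGroundstate⇒Proper T colouring proper τ τ-ground)
    where open UniqueProperColouring χ

open IsingEnergy using (UniqueProperColouring⇒NonDegenerate)

open import Data.Nat using (_+_; _*_; _≤_; _<_)

-- Patches and gluing

mapTriple : ∀ {m n} → (Fin m → Fin n) → Triple m → Triple n
mapTriple f (x , y , z) = f x , f y , f z

mapEdge : ∀ {m n} → (Fin m → Fin n) → Edge m → Edge n
mapEdge f (x , y) = f x , f y

mapEdge-injective : ∀ {m n} {f : Fin m → Fin n} → (∀ {x y} → f x ≡ f y → x ≡ y) →
                    ∀ {e e′} → mapEdge f e ≡ mapEdge f e′ → e ≡ e′
mapEdge-injective f-injective {_ , _} {_ , _} eq with ,-injective eq
... | eq₁ , eq₂ = cong₂ _,_ (f-injective eq₁) (f-injective eq₂)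

allCorners : ∀ {n} → List (Triple n) → List (Triple n)
allCorners = concatMap corners

dirEdges-++ : ∀ {n} (F F′ : List (Triple n)) → dirEdges (F ++ F′) ≡ dirEdges F ++ dirEdges F′
dirEdges-++ = ListP.concatMap-++ _

allCorners-++ : ∀ {n} (F F′ : List (Triple n)) → allCorners (F ++ F′) ≡ allCorners F ++ allCorners F′
allCorners-++ = ListP.concatMap-++ corners

dirEdges-map : ∀ {m n} (f : Fin m → Fin n) F → dirEdges (map (mapTriple f) F) ≡ map (mapEdge f) (dirEdges F)
dirEdges-map f []              = refl
dirEdges-map f ((x , y , z) ∷ F) = cong (λ es → (f x , f y) ∷ (f y , f z) ∷ (f z , f x) ∷ es) (dirEdges-map f F)

allCorners-map : ∀ {m n} (f : Fin m → Fin n) F → allCorners (map (mapTriple f) F) ≡ map (mapTriple f) (allCorners F)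
allCorners-map f []              = refl
allCorners-map f ((x , y , z) ∷ F) =
  cong (λ ts → (f x , f y , f z) ∷ (f y , f z , f x) ∷ (f z , f x , f y) ∷ ts) (allCorners-map f F)

length-dirEdges : ∀ {n} (F : List (Triple n)) → length (dirEdges F) ≡ 3 * length F
length-dirEdges []      = refl
length-dirEdges (_ ∷ F) = trans (cong (3 +_) (length-dirEdges F)) (sym (ℕP.*-suc 3 (length F)))

∂₀ ∂₁ ∂₂ : ∀ {k} → Fin (3 + k)
∂₀ = zero
∂₁ = suc zero
∂₂ = suc (suc zero)

interior : ∀ {k} → Fin k → Fin (3 + k)
interior j = suc (suc (suc j))

isBoundary : ∀ {k} → Fin (3 + k) → Bool
isBoundary zero                = true
isBoundary (suc zero)          = true
isBoundary (suc (suc zero))    = true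
isBoundary (suc (suc (suc _))) = false

boundaryEdges : ∀ {k} → List (Edge (3 + k))
boundaryEdges = (∂₀ , ∂₁) ∷ (∂₁ , ∂₂) ∷ (∂₂ , ∂₀) ∷ []

-- A triangulated surface of genus h with one triangular hole, on the vertex set Fin (3 + k): the
-- boundary ∂₀ ∂₁ ∂₂ of the hole is oriented like a face, and the other k vertices are interior.
-- The first face (mark₁ , mark₂ , mark₃) is where the next patch will be glued.
record Patch (k h : ℕ) : Set₁ where
  field
    mark₁ mark₂ mark₃ : Fin (3 + k)
    faces₀            : List (Triple (3 + k))

  faces : List (Triple (3 + k))
  faces = (mark₁ , mark₂ , mark₃) ∷ faces₀

  edges : List (Edge (3 + k))
  edges = dirEdges faces

  LinkClosed : Fin (3 + k) → (Fin (3 + k) → Set) → Set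
  LinkClosed w P = ∀ {x y} → (w , x , y) ∈ allCorners faces → P x → P y

  -- The link of w is a path from q to r.
  LinkIsPath : Fin (3 + k) → Fin (3 + k) → Fin (3 + k) → Set₁
  LinkIsPath w q r =
    (∀ P → LinkClosed w P → ∀ x → (w , x) ∈ edges → P x → P r) ×
    (∀ P → LinkClosed w P → P q → ∀ x → (w , x) ∈ edges → P x)

  field
    faceDistinct   : ∀ {x y z} → (x , y , z) ∈ faces → (x ≢ y) × (y ≢ z) × (z ≢ x)
    dirUnique      : Unique edges
    boundary⊆edges : All (_∈ edges) boundaryEdges
    boundaryChords : All (λ (u , v) → isBoundary u ≡ false ⊎ isBoundary v ≡ false ⊎ (u , v) ∈ boundaryEdges) edges
    reverse        : All (λ e → swap e ∈ edges ⊎ e ∈ boundaryEdges) edges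
    noIsolated     : ∀ j → ∃ λ u → (interior j , u) ∈ edges
    connected      : ∀ (P : Fin (3 + k) → Set) → (∃ λ x → P x) → (∀ {u v} → (u , v) ∈ edges → P u → P v) → ∀ v → P v
    linkCycle      : ∀ j (P : Fin (3 + k) → Set) → LinkClosed (interior j) P →
                     (∃ λ x → (interior j , x) ∈ edges × P x) → ∀ x → (interior j , x) ∈ edges → P x
    link₀          : LinkIsPath ∂₀ ∂₁ ∂₂
    link₁          : LinkIsPath ∂₁ ∂₂ ∂₀
    link₂          : LinkIsPath ∂₂ ∂₀ ∂₁
    euler          : length faces ≡ 2 * k + 4 * h + 1

-- Gluing a patch into the face (a , b , c) of a triangulation (a , b , c) ∷ F₀: the face is
-- removed, ∂₀ ∂₁ ∂₂ are identified with a b c, and the interior vertices become m ↑ʳ j.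
module Glue {m k h : ℕ} (P : Patch k h) (a b c : Fin m) (F₀ : List (Triple m)) where
  open Patch P

  lift : Fin m → Fin (m + k)
  lift u = u ↑ˡ k

  embed : Fin (3 + k) → Fin (m + k)
  embed zero                = lift a
  embed (suc zero)          = lift b
  embed (suc (suc zero))    = lift c
  embed (suc (suc (suc j))) = m ↑ʳ j

  gluedFaces : List (Triple (m + k))
  gluedFaces = map (mapTriple embed) faces ++ map (mapTriple lift) F₀

  gluedTail : List (Triple (m + k))
  gluedTail = map (mapTriple embed) faces₀ ++ map (mapTriple lift) F₀

  gluedEdges≡ : dirEdges gluedFaces ≡ map (mapEdge embed) edges ++ map (mapEdge lift) (dirEdges F₀)
  gluedEdges≡ = trans (dirEdges-++ (map (mapTriple embed) faces) (map (mapTriple lift) F₀))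
                      (cong₂ _++_ (dirEdges-map embed faces) (dirEdges-map lift F₀))

  gluedCorners≡ : allCorners gluedFaces ≡ map (mapTriple embed) (allCorners faces) ++ map (mapTriple lift) (allCorners F₀)
  gluedCorners≡ = trans (allCorners-++ (map (mapTriple embed) faces) (map (mapTriple lift) F₀))
                        (cong₂ _++_ (allCorners-map embed faces) (allCorners-map lift F₀))

  lift-injective : ∀ {u v} → lift u ≡ lift v → u ≡ v
  lift-injective = FinP.↑ˡ-injective k _ _

  lift≢↑ʳ : ∀ u j → lift u ≢ m ↑ʳ j
  lift≢↑ʳ u j eq = ℕP.<⇒≱ (FinP.toℕ<n u) (subst (m ℕ.≤_) m+j≡u (ℕP.m≤m+n m (toℕ j)))
    where
    m+j≡u : m + toℕ j ≡ toℕ u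
    m+j≡u = trans (sym (FinP.toℕ-↑ʳ m j)) (trans (cong toℕ (sym eq)) (FinP.toℕ-↑ˡ u k))

  lift-or-↑ʳ : ∀ x → (∃ λ u → x ≡ lift u) ⊎ (∃ λ j → x ≡ m ↑ʳ j)
  lift-or-↑ʳ x with Fin.splitAt m x in eq
  ... | inj₁ u = inj₁ (u , sym (FinP.splitAt⁻¹-↑ˡ eq))
  ... | inj₂ j = inj₂ (j , sym (FinP.splitAt⁻¹-↑ʳ eq))

  embed-edge∈ : ∀ {e} → e ∈ edges → mapEdge embed e ∈ dirEdges gluedFaces
  embed-edge∈ {e} p = subst (mapEdge embed e ∈_) (sym gluedEdges≡) (∈-++⁺ˡ (∈-map⁺ (mapEdge embed) p))

  lift-edge∈ : ∀ {e} → e ∈ dirEdges F₀ → mapEdge lift e ∈ dirEdges gluedFaces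
  lift-edge∈ {e} p =
    subst (mapEdge lift e ∈_) (sym gluedEdges≡) (∈-++⁺ʳ (map (mapEdge embed) edges) (∈-map⁺ (mapEdge lift) p))

  embed-corner∈ : ∀ {t} → t ∈ allCorners faces → mapTriple embed t ∈ allCorners gluedFaces
  embed-corner∈ {t} p = subst (mapTriple embed t ∈_) (sym gluedCorners≡) (∈-++⁺ˡ (∈-map⁺ (mapTriple embed) p))

  lift-corner∈ : ∀ {t} → t ∈ allCorners F₀ → mapTriple lift t ∈ allCorners gluedFaces
  lift-corner∈ {t} p = subst (mapTriple lift t ∈_) (sym gluedCorners≡)
    (∈-++⁺ʳ (map (mapTriple embed) (allCorners faces)) (∈-map⁺ (mapTriple lift) p))

  gluedEdge-cases : ∀ {e} → e ∈ dirEdges gluedFaces →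
    (∃ λ e′ → e′ ∈ edges × e ≡ mapEdge embed e′) ⊎ (∃ λ e′ → e′ ∈ dirEdges F₀ × e ≡ mapEdge lift e′)
  gluedEdge-cases {e} p with ∈-++⁻ (map (mapEdge embed) edges) (subst (e ∈_) gluedEdges≡ p)
  ... | inj₁ q = inj₁ (∈-map⁻ (mapEdge embed) q)
  ... | inj₂ q = inj₂ (∈-map⁻ (mapEdge lift) q)

  gluedCorner-cases : ∀ {t} → t ∈ allCorners gluedFaces →
    (∃ λ t′ → t′ ∈ allCorners faces × t ≡ mapTriple embed t′) ⊎ (∃ λ t′ → t′ ∈ allCorners F₀ × t ≡ mapTriple lift t′)
  gluedCorner-cases {t} p with ∈-++⁻ (map (mapTriple embed) (allCorners faces)) (subst (t ∈_) gluedCorners≡ p)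
  ... | inj₁ q = inj₁ (∈-map⁻ (mapTriple embed) q)
  ... | inj₂ q = inj₂ (∈-map⁻ (mapTriple lift) q)

  lift⁻¹ : Subset (m + k) → Subset m
  lift⁻¹ S = tabulate (λ u → lookup S (lift u))

  ∈-lift⁻¹⁻ : ∀ S {u} → u ∈ₛ lift⁻¹ S → lift u ∈ₛ S
  ∈-lift⁻¹⁻ S {u} p = VecP.lookup⇒[]= (lift u) S
    (trans (sym (VecP.lookup∘tabulate (λ u → lookup S (lift u)) u)) (VecP.[]=⇒lookup p))

  ∈-lift⁻¹⁺ : ∀ S {u} → lift u ∈ₛ S → u ∈ₛ lift⁻¹ S
  ∈-lift⁻¹⁺ S {u} p = VecP.lookup⇒[]= u (lift⁻¹ S)
    (trans (VecP.lookup∘tabulate (λ u → lookup S (lift u)) u) (VecP.[]=⇒lookup p))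

  module _ {g} (T : IsTriangulation ((a , b , c) ∷ F₀) g) where
    private
      module T = IsTriangulation T
      D₀ D′ : List (Edge _)
      D₀ = dirEdges F₀
      D′ = dirEdges gluedFaces

    a≢b : a ≢ b
    a≢b = proj₁ (T.faceDistinct (here refl))
    b≢c : b ≢ c
    b≢c = proj₁ (proj₂ (T.faceDistinct (here refl)))
    c≢a : c ≢ a
    c≢a = proj₂ (proj₂ (T.faceDistinct (here refl)))

    embed-injective : ∀ x y → embed x ≡ embed y → x ≡ y
    embed-injective zero                zero                e = refl
    embed-injective zero                (suc zero)          e = ⊥-elim (a≢b (lift-injective e))
    embed-injective zero                (suc (suc zero))    e = ⊥-elim (c≢a (sym (lift-injective e)))
    embed-injective zero                (suc (suc (suc j))) e = ⊥-elim (lift≢↑ʳ a j e)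
    embed-injective (suc zero)          zero                e = ⊥-elim (a≢b (sym (lift-injective e)))
    embed-injective (suc zero)          (suc zero)          e = refl
    embed-injective (suc zero)          (suc (suc zero))    e = ⊥-elim (b≢c (lift-injective e))
    embed-injective (suc zero)          (suc (suc (suc j))) e = ⊥-elim (lift≢↑ʳ b j e)
    embed-injective (suc (suc zero))    zero                e = ⊥-elim (c≢a (lift-injective e))
    embed-injective (suc (suc zero))    (suc zero)          e = ⊥-elim (b≢c (sym (lift-injective e)))
    embed-injective (suc (suc zero))    (suc (suc zero))    e = refl
    embed-injective (suc (suc zero))    (suc (suc (suc j))) e = ⊥-elim (lift≢↑ʳ c j e)
    embed-injective (suc (suc (suc i))) zero                e = ⊥-elim (lift≢↑ʳ a i (sym e))
    embed-injective (suc (suc (suc i))) (suc zero)          e = ⊥-elim (lift≢↑ʳ b i (sym e))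
    embed-injective (suc (suc (suc i))) (suc (suc zero))    e = ⊥-elim (lift≢↑ʳ c i (sym e))
    embed-injective (suc (suc (suc i))) (suc (suc (suc j))) e = cong interior (FinP.↑ʳ-injective m i j e)

    embed≡lift⇒isBoundary : ∀ x u → embed x ≡ lift u → isBoundary x ≢ false
    embed≡lift⇒isBoundary zero                u e = λ ()
    embed≡lift⇒isBoundary (suc zero)          u e = λ ()
    embed≡lift⇒isBoundary (suc (suc zero))    u e = λ ()
    embed≡lift⇒isBoundary (suc (suc (suc j))) u e = λ _ → lift≢↑ʳ u j (sym e)

    embed≡lift⇒abc : ∀ x u → embed x ≡ lift u → u ≡ a ⊎ u ≡ b ⊎ u ≡ c
    embed≡lift⇒abc zero                u e = inj₁ (sym (lift-injective e))
    embed≡lift⇒abc (suc zero)          u e = inj₂ (inj₁ (sym (lift-injective e)))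
    embed≡lift⇒abc (suc (suc zero))    u e = inj₂ (inj₂ (sym (lift-injective e)))
    embed≡lift⇒abc (suc (suc (suc j))) u e = ⊥-elim (lift≢↑ʳ u j (sym e))

    ∂₀∂₁∈ : (∂₀ , ∂₁) ∈ edges
    ∂₀∂₁∈ = All.lookup boundary⊆edges (here refl)
    ∂₁∂₂∈ : (∂₁ , ∂₂) ∈ edges
    ∂₁∂₂∈ = All.lookup boundary⊆edges (there (here refl))
    ∂₂∂₀∈ : (∂₂ , ∂₀) ∈ edges
    ∂₂∂₀∈ = All.lookup boundary⊆edges (there (there (here refl)))

    glued-faceDistinct : ∀ {x y z} → (x , y , z) ∈ gluedFaces → (x ≢ y) × (y ≢ z) × (z ≢ x)
    glued-faceDistinct p with ∈-++⁻ (map (mapTriple embed) faces) p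
    ... | inj₁ q with ∈-map⁻ (mapTriple embed) q
    ...   | (x , y , z) , r , refl with faceDistinct r
    ...     | x≢y , y≢z , z≢x = x≢y ∘ embed-injective x y , y≢z ∘ embed-injective y z , z≢x ∘ embed-injective z x
    glued-faceDistinct p | inj₂ q with ∈-map⁻ (mapTriple lift) q
    ...   | (x , y , z) , r , refl with T.faceDistinct (there r)
    ...     | x≢y , y≢z , z≢x = x≢y ∘ lift-injective , y≢z ∘ lift-injective , z≢x ∘ lift-injective

    private
      unique-D₀ : Unique D₀
      unique-D₀ with T.dirUnique
      ... | _ ∷ _ ∷ _ ∷ unique = unique

      abc-edges∉D₀ : (a , b) ∉ D₀ × (b , c) ∉ D₀ × (c , a) ∉ D₀
      abc-edges∉D₀ with T.dirUnique
      ... | (_ ∷ _ ∷ ab∉) ∷ (_ ∷ bc∉) ∷ ca∉ ∷ _ =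
        (λ p → All.lookup ab∉ p refl) , (λ p → All.lookup bc∉ p refl) , (λ p → All.lookup ca∉ p refl)

    boundary-lift∉ : ∀ {x y u v} → (x , y) ∈ boundaryEdges → embed x ≡ lift u → embed y ≡ lift v → (u , v) ∉ D₀
    boundary-lift∉ (here refl)                 ex ey =
      subst (_∉ D₀) (cong₂ _,_ (lift-injective ex) (lift-injective ey)) (proj₁ abc-edges∉D₀)
    boundary-lift∉ (there (here refl))         ex ey =
      subst (_∉ D₀) (cong₂ _,_ (lift-injective ex) (lift-injective ey)) (proj₁ (proj₂ abc-edges∉D₀))
    boundary-lift∉ (there (there (here refl))) ex ey =
      subst (_∉ D₀) (cong₂ _,_ (lift-injective ex) (lift-injective ey)) (proj₂ (proj₂ abc-edges∉D₀))

    -- Edges of the patch between two boundary vertices are the edges of the removed face,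
    -- which do not occur in F₀.
    embedded-lifted-disjoint : ∀ {e} → ¬ (e ∈ map (mapEdge embed) edges × e ∈ map (mapEdge lift) D₀)
    embedded-lifted-disjoint (p , q) with ∈-map⁻ (mapEdge embed) p | ∈-map⁻ (mapEdge lift) q
    ... | (x , y) , p′ , eq | (u , v) , q′ , eq′ with ,-injective (trans (sym eq) eq′)
    ...   | x≡u , y≡v with All.lookup boundaryChords p′
    ...     | inj₁ x-interior        = embed≡lift⇒isBoundary x u x≡u x-interior
    ...     | inj₂ (inj₁ y-interior) = embed≡lift⇒isBoundary y v y≡v y-interior
    ...     | inj₂ (inj₂ ∂∂)         = boundary-lift∉ ∂∂ x≡u y≡v q′

    glued-dirUnique : Unique D′
    glued-dirUnique = subst Unique (sym gluedEdges≡)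
      (Unique.++⁺ (Unique.map⁺ (mapEdge-injective (embed-injective _ _)) dirUnique)
                  (Unique.map⁺ (mapEdge-injective lift-injective) unique-D₀)
                  embedded-lifted-disjoint)

    private
      other-edge∈D₀ : ∀ {e} → e ∈ dirEdges ((a , b , c) ∷ F₀) → e ≢ (a , b) → e ≢ (b , c) → e ≢ (c , a) → e ∈ D₀
      other-edge∈D₀ (here refl)                 ≢ab _   _   = ⊥-elim (≢ab refl)
      other-edge∈D₀ (there (here refl))         _   ≢bc _   = ⊥-elim (≢bc refl)
      other-edge∈D₀ (there (there (here refl))) _   _   ≢ca = ⊥-elim (≢ca refl)
      other-edge∈D₀ (there (there (there p)))   _   _   _   = p

    ba∈D₀ : (b , a) ∈ D₀
    ba∈D₀ = other-edge∈D₀ (T.reverse (here refl))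
      (a≢b ∘ sym ∘ ,-injectiveˡ) (c≢a ∘ sym ∘ ,-injectiveʳ) (b≢c ∘ ,-injectiveˡ)

    cb∈D₀ : (c , b) ∈ D₀
    cb∈D₀ = other-edge∈D₀ (T.reverse (there (here refl)))
      (c≢a ∘ ,-injectiveˡ) (b≢c ∘ sym ∘ ,-injectiveˡ) (a≢b ∘ sym ∘ ,-injectiveʳ)

    ac∈D₀ : (a , c) ∈ D₀
    ac∈D₀ = other-edge∈D₀ (T.reverse (there (there (here refl))))
      (b≢c ∘ sym ∘ ,-injectiveʳ) (a≢b ∘ ,-injectiveˡ) (c≢a ∘ sym ∘ ,-injectiveˡ)

    glued-reverse : ∀ {u v} → (u , v) ∈ D′ → (v , u) ∈ D′
    glued-reverse p with gluedEdge-cases p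
    ... | inj₁ ((x , y) , q , refl) with All.lookup reverse q
    ...   | inj₁ yx∈                   = embed-edge∈ yx∈
    ...   | inj₂ (here refl)             = lift-edge∈ ba∈D₀
    ...   | inj₂ (there (here refl))     = lift-edge∈ cb∈D₀
    ...   | inj₂ (there (there (here refl))) = lift-edge∈ ac∈D₀
    glued-reverse p | inj₂ ((x , y) , q , refl) with T.reverse (there (there (there q)))
    ... | here refl                 = embed-edge∈ ∂₀∂₁∈
    ... | there (here refl)         = embed-edge∈ ∂₁∂₂∈
    ... | there (there (here refl)) = embed-edge∈ ∂₂∂₀∈
    ... | there (there (there yx∈)) = lift-edge∈ yx∈

    glued-noIsolated : ∀ v → ∃ λ u → (v , u) ∈ D′
    glued-noIsolated v with lift-or-↑ʳ v
    ... | inj₂ (j , refl) with noIsolated j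
    ...   | x , q = embed x , embed-edge∈ q
    glued-noIsolated v | inj₁ (u , refl) with T.noIsolated u
    ... | _ , here refl                 = lift b , embed-edge∈ ∂₀∂₁∈
    ... | _ , there (here refl)         = lift c , embed-edge∈ ∂₁∂₂∈
    ... | _ , there (there (here refl)) = lift a , embed-edge∈ ∂₂∂₀∈
    ... | x , there (there (there q))   = lift x , lift-edge∈ q

    glued-connected : ∀ (S : Subset (m + k)) → (∃ λ v → v ∈ₛ S) →
                      (∀ {u v} → (u , v) ∈ D′ → u ∈ₛ S → v ∈ₛ S) → ∀ v → v ∈ₛ S
    glued-connected S (w , w∈S) closed = all∈S
      where
      closed-patch : ∀ {x y} → (x , y) ∈ edges → embed x ∈ₛ S → embed y ∈ₛ S
      closed-patch = closed ∘ embed-edge∈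
      S₀ : Subset m
      S₀ = lift⁻¹ S
      closed₀ : ∀ {u v} → (u , v) ∈ dirEdges ((a , b , c) ∷ F₀) → u ∈ₛ S₀ → v ∈ₛ S₀
      closed₀ (here refl)                 = ∈-lift⁻¹⁺ S ∘ closed-patch ∂₀∂₁∈ ∘ ∈-lift⁻¹⁻ S
      closed₀ (there (here refl))         = ∈-lift⁻¹⁺ S ∘ closed-patch ∂₁∂₂∈ ∘ ∈-lift⁻¹⁻ S
      closed₀ (there (there (here refl))) = ∈-lift⁻¹⁺ S ∘ closed-patch ∂₂∂₀∈ ∘ ∈-lift⁻¹⁻ S
      closed₀ (there (there (there q)))   = ∈-lift⁻¹⁺ S ∘ closed (lift-edge∈ q) ∘ ∈-lift⁻¹⁻ S
      a∈S₀ : a ∈ₛ S₀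
      a∈S₀ with lift-or-↑ʳ w
      ... | inj₁ (u , refl) = T.connected S₀ (u , ∈-lift⁻¹⁺ S w∈S) closed₀ a
      ... | inj₂ (j , refl) = ∈-lift⁻¹⁺ S (connected (λ x → embed x ∈ₛ S) (interior j , w∈S) closed-patch ∂₀)
      lifted∈S : ∀ u → lift u ∈ₛ S
      lifted∈S u = ∈-lift⁻¹⁻ S (T.connected S₀ (a , a∈S₀) closed₀ u)
      all∈S : ∀ v → v ∈ₛ S
      all∈S v with lift-or-↑ʳ v
      ... | inj₁ (u , refl) = lifted∈S u
      ... | inj₂ (j , refl) = connected (λ x → embed x ∈ₛ S) (∂₀ , lifted∈S a) closed-patch (interior j)

    LinkAt : Fin (m + k) → Set
    LinkAt v = ∀ (S : Subset (m + k)) → (∃ λ x → ((v , x) ∈ D′) × (x ∈ₛ S)) →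
               (∀ {x y} → (v , x , y) ∈ allCorners gluedFaces → x ∈ₛ S → y ∈ₛ S) → ∀ x → (v , x) ∈ D′ → x ∈ₛ S

    interior-edge : ∀ j {x} → (m ↑ʳ j , x) ∈ D′ → ∃ λ z → (interior j , z) ∈ edges × x ≡ embed z
    interior-edge j p with gluedEdge-cases p
    ... | inj₁ ((y , z) , q , eq) with embed-injective (interior j) y (,-injectiveˡ eq)
    ...   | refl = z , q , ,-injectiveʳ eq
    interior-edge j p | inj₂ ((u , _) , _ , eq) = ⊥-elim (lift≢↑ʳ u j (sym (,-injectiveˡ eq)))

    interior-link : ∀ j → LinkAt (m ↑ʳ j)
    interior-link j S (x₀ , x₀∈ , x₀∈S) closed x x∈ with interior-edge j x∈
    ... | z , z∈ , refl = linkCycle j (λ y → embed y ∈ₛ S) (closed ∘ embed-corner∈) start z z∈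
      where
      start : ∃ λ y → (interior j , y) ∈ edges × embed y ∈ₛ S
      start with interior-edge j x₀∈
      ... | y , y∈ , refl = y , y∈ , x₀∈S

    -- In F₀ the link of p runs through the removed corner (p , q , r); after gluing, that
    -- corner is replaced by the link of the patch vertex w, a path from q to r.
    boundary-link : ∀ (p q r : Fin m) (w w-q w-r : Fin (3 + k)) →
      embed w ≡ lift p → embed w-q ≡ lift q → embed w-r ≡ lift r → (∀ y → embed y ≡ lift p → y ≡ w) →
      (w , w-q) ∈ edges → LinkIsPath w w-q w-r →
      (p , q) ∈ dirEdges ((a , b , c) ∷ F₀) → (p , r) ∈ dirEdges ((a , b , c) ∷ F₀) →
      (∀ {x y} → (p , x , y) ∈ allCorners ((a , b , c) ∷ F₀) → (x ≡ q × y ≡ r) ⊎ (p , x , y) ∈ allCorners F₀) →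
      LinkAt (lift p)
    boundary-link p q r w w-q w-r w↦p w-q↦q w-r↦r w-only wq∈ w-path pq∈ pr∈ corner-cases S (x₀ , x₀∈ , x₀∈S) closed =
      all∈S
      where
      Pw : Fin (3 + k) → Set
      Pw y = embed y ∈ₛ S
      closed-w : LinkClosed w Pw
      closed-w t = closed (subst (λ v → (v , _ , _) ∈ allCorners gluedFaces) w↦p (embed-corner∈ t))
      S₀ : Subset m
      S₀ = lift⁻¹ S
      edge-cases : ∀ {x} → (lift p , x) ∈ D′ →
                   (∃ λ z → (w , z) ∈ edges × x ≡ embed z) ⊎ (∃ λ x′ → (p , x′) ∈ D₀ × x ≡ lift x′)
      edge-cases e∈ with gluedEdge-cases e∈
      ... | inj₁ ((y , z) , q′ , eq) with w-only y (sym (,-injectiveˡ eq))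
      ...   | refl = inj₁ (z , q′ , ,-injectiveʳ eq)
      edge-cases e∈ | inj₂ ((_ , v) , q′ , eq) with lift-injective (,-injectiveˡ eq)
      ... | refl = inj₂ (v , q′ , ,-injectiveʳ eq)
      r∈S₀ : Pw w-r → r ∈ₛ S₀
      r∈S₀ = ∈-lift⁻¹⁺ S ∘ subst (_∈ₛ S) w-r↦r
      start₀ : ∃ λ x′ → (p , x′) ∈ dirEdges ((a , b , c) ∷ F₀) × x′ ∈ₛ S₀
      start₀ with edge-cases x₀∈
      ... | inj₁ (z , z∈ , refl)   = r , pr∈ , r∈S₀ (proj₁ w-path Pw closed-w z z∈ x₀∈S)
      ... | inj₂ (x′ , x′∈ , refl) = x′ , there (there (there x′∈)) , ∈-lift⁻¹⁺ S x₀∈S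
      closed₀ : ∀ {x y} → (p , x , y) ∈ allCorners ((a , b , c) ∷ F₀) → x ∈ₛ S₀ → y ∈ₛ S₀
      closed₀ t x∈S₀ with corner-cases t
      ... | inj₁ (refl , refl) = r∈S₀ (proj₁ w-path Pw closed-w w-q wq∈ (subst (_∈ₛ S) (sym w-q↦q) (∈-lift⁻¹⁻ S x∈S₀)))
      ... | inj₂ t₀            = ∈-lift⁻¹⁺ S (closed (lift-corner∈ t₀) (∈-lift⁻¹⁻ S x∈S₀))
      link₀∈S₀ : ∀ x → (p , x) ∈ dirEdges ((a , b , c) ∷ F₀) → x ∈ₛ S₀
      link₀∈S₀ = T.linkCycle p S₀ start₀ closed₀
      all∈S : ∀ x → (lift p , x) ∈ D′ → x ∈ₛ S
      all∈S x x∈ with edge-cases x∈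
      ... | inj₁ (z , z∈ , refl)   =
        proj₂ w-path Pw closed-w (subst (_∈ₛ S) (sym w-q↦q) (∈-lift⁻¹⁻ S (link₀∈S₀ q pq∈))) z z∈
      ... | inj₂ (x′ , x′∈ , refl) = ∈-lift⁻¹⁻ S (link₀∈S₀ x′ (there (there (there x′∈))))

    untouched-link : ∀ u → u ≢ a → u ≢ b → u ≢ c → LinkAt (lift u)
    untouched-link u u≢a u≢b u≢c S (x₀ , x₀∈ , x₀∈S) closed = all∈S
      where
      S₀ : Subset m
      S₀ = lift⁻¹ S
      edge-in-F₀ : ∀ {x} → (lift u , x) ∈ D′ → ∃ λ x′ → (u , x′) ∈ D₀ × x ≡ lift x′
      edge-in-F₀ e∈ with gluedEdge-cases e∈
      ... | inj₁ ((y , _) , _ , eq) with embed≡lift⇒abc y u (sym (,-injectiveˡ eq))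
      ...   | inj₁ u≡a        = ⊥-elim (u≢a u≡a)
      ...   | inj₂ (inj₁ u≡b) = ⊥-elim (u≢b u≡b)
      ...   | inj₂ (inj₂ u≡c) = ⊥-elim (u≢c u≡c)
      edge-in-F₀ e∈ | inj₂ ((_ , v) , q , eq) with lift-injective (,-injectiveˡ eq)
      ... | refl = v , q , ,-injectiveʳ eq
      start₀ : ∃ λ x′ → (u , x′) ∈ dirEdges ((a , b , c) ∷ F₀) × x′ ∈ₛ S₀
      start₀ with edge-in-F₀ x₀∈
      ... | x′ , x′∈ , refl = x′ , there (there (there x′∈)) , ∈-lift⁻¹⁺ S x₀∈S
      closed₀ : ∀ {x y} → (u , x , y) ∈ allCorners ((a , b , c) ∷ F₀) → x ∈ₛ S₀ → y ∈ₛ S₀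
      closed₀ (here eq)                 = ⊥-elim (u≢a (,-injectiveˡ eq))
      closed₀ (there (here eq))         = ⊥-elim (u≢b (,-injectiveˡ eq))
      closed₀ (there (there (here eq))) = ⊥-elim (u≢c (,-injectiveˡ eq))
      closed₀ (there (there (there t))) = ∈-lift⁻¹⁺ S ∘ closed (lift-corner∈ t) ∘ ∈-lift⁻¹⁻ S
      all∈S : ∀ x → (lift u , x) ∈ D′ → x ∈ₛ S
      all∈S x x∈ with edge-in-F₀ x∈
      ... | x′ , x′∈ , refl = ∈-lift⁻¹⁻ S (T.linkCycle u S₀ start₀ closed₀ x′ (there (there (there x′∈))))

    private
      corners-at-a : ∀ {x y} → (a , x , y) ∈ allCorners ((a , b , c) ∷ F₀) → (x ≡ b × y ≡ c) ⊎ (a , x , y) ∈ allCorners F₀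
      corners-at-a (here refl)                 = inj₁ (refl , refl)
      corners-at-a (there (here eq))           = ⊥-elim (a≢b (,-injectiveˡ eq))
      corners-at-a (there (there (here eq)))   = ⊥-elim (c≢a (sym (,-injectiveˡ eq)))
      corners-at-a (there (there (there t)))   = inj₂ t

      corners-at-b : ∀ {x y} → (b , x , y) ∈ allCorners ((a , b , c) ∷ F₀) → (x ≡ c × y ≡ a) ⊎ (b , x , y) ∈ allCorners F₀
      corners-at-b (here eq)                   = ⊥-elim (a≢b (sym (,-injectiveˡ eq)))
      corners-at-b (there (here refl))         = inj₁ (refl , refl)
      corners-at-b (there (there (here eq)))   = ⊥-elim (b≢c (,-injectiveˡ eq))
      corners-at-b (there (there (there t)))   = inj₂ t

      corners-at-c : ∀ {x y} → (c , x , y) ∈ allCorners ((a , b , c) ∷ F₀) → (x ≡ a × y ≡ b) ⊎ (c , x , y) ∈ allCorners F₀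
      corners-at-c (here eq)                   = ⊥-elim (c≢a (,-injectiveˡ eq))
      corners-at-c (there (here eq))           = ⊥-elim (b≢c (sym (,-injectiveˡ eq)))
      corners-at-c (there (there (here refl))) = inj₁ (refl , refl)
      corners-at-c (there (there (there t)))   = inj₂ t

    glued-linkCycle : ∀ v → LinkAt v
    glued-linkCycle v with lift-or-↑ʳ v
    ... | inj₂ (j , refl) = interior-link j
    ... | inj₁ (u , refl) with u FinP.≟ a | u FinP.≟ b | u FinP.≟ c
    ...   | yes refl | _        | _        = boundary-link a b c ∂₀ ∂₁ ∂₂ refl refl refl (λ y → embed-injective y ∂₀)
                                               ∂₀∂₁∈ link₀ (here refl) (T.reverse (there (there (here refl)))) corners-at-a
    ...   | no _     | yes refl | _        = boundary-link b c a ∂₁ ∂₂ ∂₀ refl refl refl (λ y → embed-injective y ∂₁)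
                                               ∂₁∂₂∈ link₁ (there (here refl)) (T.reverse (here refl)) corners-at-b
    ...   | no _     | no _     | yes refl = boundary-link c a b ∂₂ ∂₀ ∂₁ refl refl refl (λ y → embed-injective y ∂₂)
                                               ∂₂∂₀∈ link₂ (there (there (here refl))) (T.reverse (there (here refl))) corners-at-c
    ...   | no u≢a   | no u≢b   | no u≢c   = untouched-link u u≢a u≢b u≢c

    length-gluedFaces : length gluedFaces ≡ (2 * k + 4 * h + 1) + length F₀
    length-gluedFaces = begin
      length gluedFaces                                                   ≡⟨ ListP.length-++ (map (mapTriple embed) faces) ⟩
      length (map (mapTriple embed) faces) + length (map (mapTriple lift) F₀) ≡⟨ cong₂ _+_ (ListP.length-map _ faces) (ListP.length-map _ F₀) ⟩
      length faces + length F₀                                            ≡⟨ cong (_+ length F₀) euler ⟩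
      (2 * k + 4 * h + 1) + length F₀                                     ∎
      where open ≡-Reasoning

    glued-euler : 2 * (m + k) + 2 * length gluedFaces + 4 * (g + h) ≡ length D′ + 4
    glued-euler = begin
      2 * (m + k) + 2 * length gluedFaces + 4 * (g + h)       ≡⟨ cong (λ l → 2 * (m + k) + 2 * l + 4 * (g + h)) length-gluedFaces ⟩
      2 * (m + k) + 2 * (p + f) + 4 * (g + h)                 ≡⟨ split-old m k h f g ⟩
      (2 * m + 2 * suc f + 4 * g) + (6 * k + 12 * h)          ≡⟨ cong (_+ (6 * k + 12 * h)) T.euler ⟩
      (length (dirEdges ((a , b , c) ∷ F₀)) + 4) + (6 * k + 12 * h) ≡⟨ cong (λ l → l + 4 + (6 * k + 12 * h)) (length-dirEdges ((a , b , c) ∷ F₀)) ⟩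
      (3 * suc f + 4) + (6 * k + 12 * h)                      ≡⟨ join-new k h f ⟩
      3 * (p + f) + 4                                         ≡⟨ cong (λ l → 3 * l + 4) length-gluedFaces ⟨
      3 * length gluedFaces + 4                               ≡⟨ cong (_+ 4) (length-dirEdges gluedFaces) ⟨
      length D′ + 4                                           ∎
      where
      open ≡-Reasoning
      f p : ℕ
      f = length F₀
      p = 2 * k + 4 * h + 1
      split-old : ∀ m k h f g → 2 * (m + k) + 2 * ((2 * k + 4 * h + 1) + f) + 4 * (g + h)
                                ≡ (2 * m + 2 * suc f + 4 * g) + (6 * k + 12 * h)
      split-old = ℕ-Solver.solve-∀
      join-new : ∀ k h f → (3 * suc f + 4) + (6 * k + 12 * h) ≡ 3 * ((2 * k + 4 * h + 1) + f) + 4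
      join-new = ℕ-Solver.solve-∀

    glued-isTriangulation : IsTriangulation gluedFaces (g + h)
    glued-isTriangulation = record
      { faceDistinct = glued-faceDistinct
      ; dirUnique    = glued-dirUnique
      ; reverse      = glued-reverse
      ; noIsolated   = glued-noIsolated
      ; connected    = glued-connected
      ; linkCycle    = glued-linkCycle
      ; euler        = glued-euler
      }

-- Rigid colourings

-- The boundary colours false true false fit the colours s, not s, s of a marked face up to flipping.
colourPatch : ∀ {k} → (Fin k → Bool) → State (3 + k)
colourPatch κ zero                = false
colourPatch κ (suc zero)          = true
colourPatch κ (suc (suc zero))    = false
colourPatch κ (suc (suc (suc j))) = κ j

record ColouredPatch (k h : ℕ) : Set₁ where
  field
    patch : Patch k h
  open Patch patch
  field
    κ           : Fin k → Bool
    proper      : Proper (colourPatch κ) faces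
    mark₃-colour : colourPatch κ mark₃ ≡ colourPatch κ mark₁
    mark₂-colour : colourPatch κ mark₂ ≡ not (colourPatch κ mark₁)
    rigid       : ∀ κ′ → Proper (colourPatch κ′) faces₀ → ∀ j → κ′ j ≡ κ j

-- The marked face (a , b , c) is kept out of F₀ because a patch will replace it.
record RigidColouring {m} (a b c : Fin m) (F₀ : List (Triple m)) : Set where
  field
    colouring : State m
    colour-c  : colouring c ≡ colouring a
    colour-b  : colouring b ≡ not (colouring a)
    proper    : Proper colouring F₀
    unique    : ∀ τ → Proper τ F₀ → UpToFlip τ colouring

RigidColouring⇒UniqueProperColouring : ∀ {m} {a b c : Fin m} {F₀} →
  RigidColouring a b c F₀ → UniqueProperColouring ((a , b , c) ∷ F₀)
RigidColouring⇒UniqueProperColouring {a = a} {b} {c} ρ = record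
  { colouring = colouring
  ; proper    = abc-not-mono (colouring a) (colouring b) (colouring c) colour-c colour-b ∷ proper
  ; unique    = λ τ → unique τ ∘ All.tail
  }
  where
  open RigidColouring ρ
  abc-not-mono : ∀ x y z → z ≡ x → y ≡ not x → sameColour x y ∧ sameColour y z ≡ false
  abc-not-mono true  .false .true  refl refl = refl
  abc-not-mono false .true  .false refl refl = refl

module _ {m k h : ℕ} (P : ColouredPatch k h) (a b c : Fin m) (F₀ : List (Triple m)) where
  open ColouredPatch P
  open Patch patch using (mark₁; mark₂; mark₃; faces₀)
  open Glue patch a b c F₀

  -- The colouring of the patch is flipped to match the colour of a.
  glued-rigidColouring : RigidColouring a b c F₀ → RigidColouring (embed mark₁) (embed mark₂) (embed mark₃) gluedTail
  glued-rigidColouring ρ = record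
    { colouring = σ′
    ; colour-c  = trans (σ′-embed mark₃) (trans (cong (s xor_) mark₃-colour) (sym (σ′-embed mark₁)))
    ; colour-b  = trans (σ′-embed mark₂) (trans (cong (s xor_) mark₂-colour)
                    (trans (sym (not-distribʳ-xor s _)) (cong not (sym (σ′-embed mark₁)))))
    ; proper    = All.++⁺ (All.map⁺ (Proper-cong (sym ∘ σ′-embed) (Proper-xor s (All.tail proper))))
                          (All.map⁺ (Proper-cong (sym ∘ σ′-lift) σ-proper))
    ; unique    = unique′
    }
    where
    open RigidColouring ρ renaming (colouring to σ; proper to σ-proper; unique to σ-unique)
    s : Bool
    s = σ a
    σ′ : State (m + k)
    σ′ x = [ σ , (λ j → s xor κ j) ]′ (Fin.splitAt m x)

    σ′-lift : ∀ u → σ′ (lift u) ≡ σ u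
    σ′-lift u rewrite FinP.splitAt-↑ˡ m u k = refl

    σ′-↑ʳ : ∀ j → σ′ (m ↑ʳ j) ≡ s xor κ j
    σ′-↑ʳ j rewrite FinP.splitAt-↑ʳ m k j = refl

    σ′-embed : ∀ x → σ′ (embed x) ≡ s xor colourPatch κ x
    σ′-embed zero                = trans (σ′-lift a) (sym (xor-identityʳ s))
    σ′-embed (suc zero)          = trans (σ′-lift b) (trans colour-b (sym (xor-comm s true)))
    σ′-embed (suc (suc zero))    = trans (σ′-lift c) (trans colour-c (sym (xor-identityʳ s)))
    σ′-embed (suc (suc (suc j))) = σ′-↑ʳ j

    -- On the patch, s xor τ is a proper colouring with boundary colours false true false.
    agree : ∀ τ → Proper τ gluedTail → (∀ u → τ (lift u) ≡ σ u) → ∀ x → τ x ≡ σ′ x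
    agree τ τ-proper τ≗σ x with lift-or-↑ʳ x
    ... | inj₁ (u , refl) = trans (τ≗σ u) (sym (σ′-lift u))
    ... | inj₂ (j , refl) =
      trans (sym (xor-cancelˡ s (τ (m ↑ʳ j)))) (trans (cong (s xor_) (rigid κ′ κ′-proper j)) (sym (σ′-↑ʳ j)))
      where
      κ′ : Fin k → Bool
      κ′ i = s xor τ (m ↑ʳ i)
      κ′-colours : ∀ y → s xor τ (embed y) ≡ colourPatch κ′ y
      κ′-colours zero                = trans (cong (s xor_) (τ≗σ a)) (xor-same s)
      κ′-colours (suc zero)          = trans (cong (s xor_) (trans (τ≗σ b) colour-b))
                                             (trans (sym (not-distribʳ-xor s s)) (cong not (xor-same s)))
      κ′-colours (suc (suc zero))    = trans (cong (s xor_) (trans (τ≗σ c) colour-c)) (xor-same s)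
      κ′-colours (suc (suc (suc i))) = refl
      κ′-proper : Proper (colourPatch κ′) faces₀
      κ′-proper = Proper-cong κ′-colours (Proper-xor s (All.map⁻ (All.++⁻ˡ (map (mapTriple embed) faces₀) τ-proper)))

    unique′ : ∀ τ → Proper τ gluedTail → UpToFlip τ σ′
    unique′ τ τ-proper with σ-unique (τ ∘ lift) (All.map⁻ (All.++⁻ʳ (map (mapTriple embed) faces₀) τ-proper))
    ... | inj₁ τ≗σ  = inj₁ (agree τ τ-proper τ≗σ)
    ... | inj₂ τ≗σ̅ = inj₂ λ v → trans (sym (not-involutive (τ v)))
        (cong not (agree (not ∘ τ) (Proper-xor true {τ} τ-proper) (λ u → trans (cong not (τ≗σ̅ u)) (not-involutive (σ u))) v))

-- Certificates

_∈ᵉ?_ : ∀ {n} (e : Edge n) (E : List (Edge n)) → Dec (e ∈ E)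
_∈ᵉ?_ = DecMembership._∈?_ (≡-dec FinP._≟_ FinP._≟_)

_∈ᵗ?_ : ∀ {n} (t : Triple n) (C : List (Triple n)) → Dec (t ∈ C)
_∈ᵗ?_ = DecMembership._∈?_ (≡-dec FinP._≟_ (≡-dec FinP._≟_ FinP._≟_))

_∈ᵛ?_ : ∀ {n} (v : Fin n) (l : List (Fin n)) → Dec (v ∈ l)
_∈ᵛ?_ = DecMembership._∈?_ FinP._≟_

Distinct3 : ∀ {n} → Triple n → Set
Distinct3 (x , y , z) = (x ≢ y) × (y ≢ z) × (z ≢ x)

distinct3? : ∀ {n} (t : Triple n) → Dec (Distinct3 t)
distinct3? (x , y , z) = ¬? (x FinP.≟ y) ×-dec ¬? (y FinP.≟ z) ×-dec ¬? (z FinP.≟ x)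

-- Connectivity is certified by a spanning tree towards r, given by parents of smaller depth.
TreeStep : ∀ {n} → List (Edge n) → Fin n → (Fin n → Fin n) → (Fin n → ℕ) → Fin n → Set
TreeStep E r parent depth v = v ≡ r ⊎ ((parent v , v) ∈ E × (v , parent v) ∈ E × depth (parent v) < depth v)

treeStep? : ∀ {n} E r parent depth (v : Fin n) → Dec (TreeStep E r parent depth v)
treeStep? E r parent depth v =
  (v FinP.≟ r) ⊎-dec ((parent v , v) ∈ᵉ? E) ×-dec ((v , parent v) ∈ᵉ? E) ×-dec (depth (parent v) ℕ.<? depth v)

module _ {n} {E : List (Edge n)} {r parent depth} (tree : ∀ v → TreeStep E r parent depth v)
         (P : Fin n → Set) (closed : ∀ {u v} → (u , v) ∈ E → P u → P v) where

  private
    to-root : ∀ d v → depth v ≤ d → P v → P r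
    to-root d v _ Pv with tree v
    ... | inj₁ refl = Pv
    to-root zero    v d≤0 Pv | inj₂ (_ , _ , lt) = ⊥-elim (ℕP.n≮0 (ℕP.<-≤-trans lt d≤0))
    to-root (suc d) v dv≤ Pv | inj₂ (_ , v→p , lt) = to-root d (parent v) (ℕP.≤-pred (ℕP.≤-trans lt dv≤)) (closed v→p Pv)

    from-root : P r → ∀ d v → depth v ≤ d → P v
    from-root Pr d v _ with tree v
    ... | inj₁ refl = Pr
    from-root Pr zero    v d≤0 | inj₂ (_ , _ , lt) = ⊥-elim (ℕP.n≮0 (ℕP.<-≤-trans lt d≤0))
    from-root Pr (suc d) v dv≤ | inj₂ (p→v , _ , lt) = closed p→v (from-root Pr d (parent v) (ℕP.≤-pred (ℕP.≤-trans lt dv≤)))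

  tree-connected : (∃ λ x → P x) → ∀ v → P v
  tree-connected (x , Px) v = from-root (to-root (depth x) x ℕP.≤-refl Px) (depth v) v ℕP.≤-refl

Chain : ∀ {n} → List (Triple n) → Fin n → List (Fin n) → Set
Chain C w []           = ⊤
Chain C w (x ∷ [])     = ⊤
Chain C w (x ∷ y ∷ l)  = ((w , x , y) ∈ C) × Chain C w (y ∷ l)

chain? : ∀ {n} C w (l : List (Fin n)) → Dec (Chain C w l)
chain? C w []          = yes tt
chain? C w (x ∷ [])    = yes tt
chain? C w (x ∷ y ∷ l) = ((w , x , y) ∈ᵗ? C) ×-dec chain? C w (y ∷ l)

lastOr : ∀ {A : Set} → A → List A → A
lastOr d []      = d
lastOr d (x ∷ l) = lastOr x l

Covers : ∀ {n} → List (Edge n) → Fin n → List (Fin n) → Set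
Covers E w l = All (λ (u , x) → u ≢ w ⊎ x ∈ l) E

covers? : ∀ {n} E w (l : List (Fin n)) → Dec (Covers E w l)
covers? E w l = All.all? (λ (u , x) → ¬? (u FinP.≟ w) ⊎-dec (x ∈ᵛ? l)) E

CycleLink : ∀ {n} → List (Triple n) → List (Edge n) → Fin n → List (Fin n) → Set
CycleLink C E w []      = ⊥
CycleLink C E w (x ∷ l) = Chain C w (x ∷ l) × ((w , lastOr x l , x) ∈ C) × Covers E w (x ∷ l)

cycleLink? : ∀ {n} C E w (l : List (Fin n)) → Dec (CycleLink C E w l)
cycleLink? C E w []      = no λ ()
cycleLink? C E w (x ∷ l) = chain? C w (x ∷ l) ×-dec ((w , lastOr x l , x) ∈ᵗ? C) ×-dec covers? E w (x ∷ l)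

PathLink : ∀ {n} → List (Triple n) → List (Edge n) → Fin n → Fin n → Fin n → List (Fin n) → Set
PathLink C E w q r []      = ⊥
PathLink C E w q r (x ∷ l) = (x ≡ q) × Chain C w (x ∷ l) × (lastOr x l ≡ r) × Covers E w (x ∷ l)

pathLink? : ∀ {n} C E w q r (l : List (Fin n)) → Dec (PathLink C E w q r l)
pathLink? C E w q r []      = no λ ()
pathLink? C E w q r (x ∷ l) =
  (x FinP.≟ q) ×-dec chain? C w (x ∷ l) ×-dec (lastOr x l FinP.≟ r) ×-dec covers? E w (x ∷ l)

module _ {n} {C : List (Triple n)} {w : Fin n} (P : Fin n → Set)
         (closed : ∀ {x y} → (w , x , y) ∈ C → P x → P y) where

  private
    chain-all : ∀ x l → Chain C w (x ∷ l) → P x → All P (x ∷ l)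
    chain-all x []      _            Px = Px ∷ []
    chain-all x (y ∷ l) (xy∈ , chain) Px = Px ∷ chain-all y l chain (closed xy∈ Px)

    chain-last : ∀ x l → Chain C w (x ∷ l) → ∀ {y} → y ∈ x ∷ l → P y → P (lastOr x l)
    chain-last x []      _            (here refl) Py = Py
    chain-last x (y ∷ l) (xy∈ , chain) (here refl) Py = chain-last y l chain (here refl) (closed xy∈ Py)
    chain-last x (y ∷ l) (_   , chain) (there p)   Py = chain-last y l chain p Py

    covers-∈ : ∀ {E : List (Edge n)} {l} → Covers E w l → ∀ {x} → (w , x) ∈ E → x ∈ l
    covers-∈ covers wx∈ with All.lookup covers wx∈
    ... | inj₁ w≢w = ⊥-elim (w≢w refl)
    ... | inj₂ x∈l = x∈l

  cycleLink-closed : ∀ {E} l → CycleLink C E w l → (∃ λ x → (w , x) ∈ E × P x) → ∀ x → (w , x) ∈ E → P x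
  cycleLink-closed {E} (x₀ ∷ l) (chain , wrap , covers) (x , x∈ , Px) y y∈ =
    All.lookup (chain-all x₀ l chain (closed wrap (chain-last x₀ l chain (covers-∈ {E} covers x∈) Px)))
               (covers-∈ {E} covers y∈)

  pathLink-end : ∀ {E q r} l → PathLink C E w q r l → ∀ x → (w , x) ∈ E → P x → P r
  pathLink-end {E} (x₀ ∷ l) (_ , chain , refl , covers) x x∈ Px = chain-last x₀ l chain (covers-∈ {E} covers x∈) Px

  pathLink-start : ∀ {E q r} l → PathLink C E w q r l → P q → ∀ x → (w , x) ∈ E → P x
  pathLink-start {E} (x₀ ∷ l) (refl , chain , _ , covers) Pq x x∈ = All.lookup (chain-all x₀ l chain Pq) (covers-∈ {E} covers x∈)

record PatchCertificate (k h : ℕ) : Set where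
  field
    mark₁ mark₂ mark₃     : Fin (3 + k)
    faces₀               : List (Triple (3 + k))
    parent               : Fin (3 + k) → Fin (3 + k)
    depth                : Fin (3 + k) → ℕ
    neighbour            : Fin k → Fin (3 + k)
    link                 : Fin k → List (Fin (3 + k))
    path₀ path₁ path₂    : List (Fin (3 + k))

module CertifiedPatch {k h} (cert : PatchCertificate k h) where
  open PatchCertificate cert

  private
    F : List (Triple (3 + k))
    F = (mark₁ , mark₂ , mark₃) ∷ faces₀
    E : List (Edge (3 + k))
    E = dirEdges F
    C : List (Triple (3 + k))
    C = allCorners F

  Checks : Set
  Checks = All Distinct3 F × Unique E × All (_∈ E) boundaryEdges
         × All (λ (u , v) → isBoundary u ≡ false ⊎ isBoundary v ≡ false ⊎ (u , v) ∈ boundaryEdges) E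
         × All (λ e → swap e ∈ E ⊎ e ∈ boundaryEdges) E
         × (∀ j → (interior j , neighbour j) ∈ E) × (∀ v → TreeStep E ∂₀ parent depth v)
         × (∀ j → CycleLink C E (interior j) (link j))
         × PathLink C E ∂₀ ∂₁ ∂₂ path₀ × PathLink C E ∂₁ ∂₂ ∂₀ path₁ × PathLink C E ∂₂ ∂₀ ∂₁ path₂
         × length F ≡ 2 * k + 4 * h + 1

  checks? : Dec Checks
  checks? = All.all? distinct3? F
    ×-dec UniqueDec.unique? (≡-dec FinP._≟_ FinP._≟_) E
    ×-dec All.all? (_∈ᵉ? E) boundaryEdges
    ×-dec All.all? (λ (u , v) → (isBoundary u BoolP.≟ false) ⊎-dec (isBoundary v BoolP.≟ false) ⊎-dec ((u , v) ∈ᵉ? boundaryEdges)) E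
    ×-dec All.all? (λ e → (swap e ∈ᵉ? E) ⊎-dec (e ∈ᵉ? boundaryEdges)) E
    ×-dec FinP.all? (λ j → (interior j , neighbour j) ∈ᵉ? E)
    ×-dec FinP.all? (treeStep? E ∂₀ parent depth)
    ×-dec FinP.all? (λ j → cycleLink? C E (interior j) (link j))
    ×-dec pathLink? C E ∂₀ ∂₁ ∂₂ path₀ ×-dec pathLink? C E ∂₁ ∂₂ ∂₀ path₁ ×-dec pathLink? C E ∂₂ ∂₀ ∂₁ path₂
    ×-dec (length F ℕ.≟ 2 * k + 4 * h + 1)

  patch : Checks → Patch k h
  patch (distinct , unique , boundary , chords , rev , nbr , tree , cycles , p₀ , p₁ , p₂ , euler) = record
    { mark₁ = mark₁ ; mark₂ = mark₂ ; mark₃ = mark₃ ; faces₀ = faces₀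
    ; faceDistinct   = All.lookup distinct
    ; dirUnique      = unique
    ; boundary⊆edges = boundary
    ; boundaryChords = chords
    ; reverse        = rev
    ; noIsolated     = λ j → neighbour j , nbr j
    ; connected      = λ P start closed → tree-connected tree P closed start
    ; linkCycle      = λ j P closed → cycleLink-closed P closed (link j) (cycles j)
    ; link₀          = (λ P closed → pathLink-end P closed path₀ p₀) , (λ P closed → pathLink-start P closed path₀ p₀)
    ; link₁          = (λ P closed → pathLink-end P closed path₁ p₁) , (λ P closed → pathLink-start P closed path₁ p₁)
    ; link₂          = (λ P closed → pathLink-end P closed path₂ p₂) , (λ P closed → pathLink-start P closed path₂ p₂)
    ; euler          = euler
    }

module CertifiedTriangulation {n} (F : List (Triple n)) (g : ℕ) (root : Fin n) (parent : Fin n → Fin n)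
                              (depth : Fin n → ℕ) (neighbour : Fin n → Fin n) (link : Fin n → List (Fin n)) where
  private
    E : List (Edge n)
    E = dirEdges F
    C : List (Triple n)
    C = allCorners F

  Checks : Set
  Checks = All Distinct3 F × Unique E × All (λ e → swap e ∈ E) E × (∀ v → (v , neighbour v) ∈ E)
         × (∀ v → TreeStep E root parent depth v) × (∀ v → CycleLink C E v (link v))
         × 2 * n + 2 * length F + 4 * g ≡ length E + 4

  checks? : Dec Checks
  checks? = All.all? distinct3? F
    ×-dec UniqueDec.unique? (≡-dec FinP._≟_ FinP._≟_) E
    ×-dec All.all? (λ e → swap e ∈ᵉ? E) E
    ×-dec FinP.all? (λ v → (v , neighbour v) ∈ᵉ? E)
    ×-dec FinP.all? (treeStep? E root parent depth)
    ×-dec FinP.all? (λ v → cycleLink? C E v (link v))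
    ×-dec (2 * n + 2 * length F + 4 * g ℕ.≟ length E + 4)

  isTriangulation : Checks → IsTriangulation F g
  isTriangulation (distinct , unique , rev , nbr , tree , cycles , euler) = record
    { faceDistinct = All.lookup distinct
    ; dirUnique    = unique
    ; reverse      = All.lookup rev
    ; noIsolated   = λ v → neighbour v , nbr v
    ; connected    = λ S start closed → tree-connected tree (_∈ₛ S) closed start
    ; linkCycle    = λ v S start closed → cycleLink-closed (_∈ₛ S) closed (link v) (cycles v) start
    ; euler        = euler
    }

-- Exhaustive search

∀-State? : ∀ n {P : State n → Set} → (∀ {σ τ} → (∀ v → σ v ≡ τ v) → P σ → P τ) →
           (∀ σ → Dec (P σ)) → Dec (∀ σ → P σ)
∀-State? zero    resp P? = map′ (λ P-empty σ → resp (λ ()) P-empty) (λ ∀P → ∀P _) (P? (λ ()))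
∀-State? (suc n) {P} resp P? =
  map′ by-head (λ ∀P → (λ τ → ∀P (true Vector.∷ τ)) , (λ τ → ∀P (false Vector.∷ τ)))
       (∀-State? n (λ σ≗τ → resp (∷-cong true σ≗τ)) (λ τ → P? (true Vector.∷ τ))
        ×-dec ∀-State? n (λ σ≗τ → resp (∷-cong false σ≗τ)) (λ τ → P? (false Vector.∷ τ)))
  where
  ∷-cong : ∀ b {σ τ : State n} → (∀ v → σ v ≡ τ v) → ∀ v → (b Vector.∷ σ) v ≡ (b Vector.∷ τ) v
  ∷-cong b σ≗τ zero    = refl
  ∷-cong b σ≗τ (suc v) = σ≗τ v
  head∷tail : ∀ (σ : State (suc n)) v → (Vector.head σ Vector.∷ Vector.tail σ) v ≡ σ v
  head∷tail σ zero    = refl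
  head∷tail σ (suc v) = refl
  by-head : (∀ τ → P (true Vector.∷ τ)) × (∀ τ → P (false Vector.∷ τ)) → ∀ σ → P σ
  by-head (P-true , P-false) σ = resp (head∷tail σ) (with-head (σ zero))
    where
    with-head : ∀ b → P (b Vector.∷ Vector.tail σ)
    with-head true  = P-true (Vector.tail σ)
    with-head false = P-false (Vector.tail σ)

Proper? : ∀ {n} (σ : State n) F → Dec (Proper σ F)
Proper? σ = All.all? (λ t → monochromatic σ t BoolP.≟ false)

upToFlip? : ∀ {n} (τ σ : State n) → Dec (UpToFlip τ σ)
upToFlip? τ σ = FinP.all? (λ v → τ v BoolP.≟ σ v) ⊎-dec FinP.all? (λ v → τ v BoolP.≟ not (σ v))

colourPatch-cong : ∀ {k} {κ κ′ : Fin k → Bool} → (∀ j → κ j ≡ κ′ j) → ∀ v → colourPatch κ v ≡ colourPatch κ′ v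
colourPatch-cong κ≗κ′ zero                = refl
colourPatch-cong κ≗κ′ (suc zero)          = refl
colourPatch-cong κ≗κ′ (suc (suc zero))    = refl
colourPatch-cong κ≗κ′ (suc (suc (suc j))) = κ≗κ′ j

rigid? : ∀ {k} (F : List (Triple (3 + k))) (κ : Fin k → Bool) →
         Dec (∀ κ′ → Proper (colourPatch κ′) F → ∀ j → κ′ j ≡ κ j)
rigid? {k} F κ = ∀-State? k
  (λ κ′≗κ″ rigid proper j → trans (sym (κ′≗κ″ j)) (rigid (Proper-cong (colourPatch-cong (sym ∘ κ′≗κ″)) proper) j))
  (λ κ′ → Proper? (colourPatch κ′) F →-dec FinP.all? (λ j → κ′ j BoolP.≟ κ j))

unique? : ∀ {n} (σ : State n) F → Dec (∀ τ → Proper τ F → UpToFlip τ σ)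
unique? {n} σ F = ∀-State? n
  (λ τ≗τ′ unique proper → Sum.map (λ τ≗σ v → trans (sym (τ≗τ′ v)) (τ≗σ v)) (λ τ≗σ̅ v → trans (sym (τ≗τ′ v)) (τ≗σ̅ v))
                                   (unique (Proper-cong (sym ∘ τ≗τ′) proper)))
  (λ τ → Proper? τ F →-dec upToFlip? τ σ)

-- The construction

stellarCertificate : PatchCertificate 1 0
stellarCertificate = record
  { mark₁     = # 1 ; mark₂ = # 2 ; mark₃ = # 3
  ; faces₀    = (# 0 , # 1 , # 3) ∷ (# 2 , # 0 , # 3) ∷ []
  ; parent    = lookup (# 0 ∷ # 3 ∷ # 3 ∷ # 0 ∷ [])
  ; depth     = lookup (0 ∷ 2 ∷ 2 ∷ 1 ∷ [])
  ; neighbour = lookup (# 1 ∷ [])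
  ; link      = lookup ((# 1 ∷ # 2 ∷ # 0 ∷ []) ∷ [])
  ; path₀     = # 1 ∷ # 3 ∷ # 2 ∷ []
  ; path₁     = # 2 ∷ # 3 ∷ # 0 ∷ []
  ; path₂     = # 0 ∷ # 3 ∷ # 1 ∷ []
  }

handleCertificate : PatchCertificate 6 1
handleCertificate = record
  { mark₁     = # 7 ; mark₂ = # 4 ; mark₃ = # 6
  ; faces₀    = (# 4 , # 7 , # 5) ∷ (# 5 , # 7 , # 8) ∷ (# 0 , # 8 , # 6) ∷ (# 6 , # 1 , # 7) ∷ (# 7 , # 1 , # 2) ∷ (# 8 , # 3 , # 6) ∷
                 (# 1 , # 5 , # 8) ∷ (# 8 , # 0 , # 1) ∷ (# 3 , # 8 , # 7) ∷ (# 7 , # 2 , # 3) ∷ (# 2 , # 4 , # 5) ∷ (# 5 , # 3 , # 2) ∷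
                 (# 4 , # 2 , # 0) ∷ (# 0 , # 6 , # 4) ∷ (# 5 , # 1 , # 6) ∷ (# 6 , # 3 , # 5) ∷ []
  ; parent    = lookup (# 0 ∷ # 8 ∷ # 4 ∷ # 8 ∷ # 0 ∷ # 8 ∷ # 0 ∷ # 8 ∷ # 0 ∷ [])
  ; depth     = lookup (0 ∷ 2 ∷ 2 ∷ 2 ∷ 1 ∷ 2 ∷ 1 ∷ 2 ∷ 1 ∷ [])
  ; neighbour = lookup (# 6 ∷ # 6 ∷ # 4 ∷ # 7 ∷ # 4 ∷ # 5 ∷ [])
  ; link      = lookup ((# 6 ∷ # 8 ∷ # 7 ∷ # 2 ∷ # 5 ∷ [])
                 ∷ (# 6 ∷ # 7 ∷ # 5 ∷ # 2 ∷ # 0 ∷ [])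
                 ∷ (# 4 ∷ # 7 ∷ # 8 ∷ # 1 ∷ # 6 ∷ # 3 ∷ # 2 ∷ [])
                 ∷ (# 7 ∷ # 4 ∷ # 0 ∷ # 8 ∷ # 3 ∷ # 5 ∷ # 1 ∷ [])
                 ∷ (# 4 ∷ # 6 ∷ # 1 ∷ # 2 ∷ # 3 ∷ # 8 ∷ # 5 ∷ [])
                 ∷ (# 5 ∷ # 7 ∷ # 3 ∷ # 6 ∷ # 0 ∷ # 1 ∷ [])
                 ∷ [])
  ; path₀     = # 1 ∷ # 8 ∷ # 6 ∷ # 4 ∷ # 2 ∷ []
  ; path₁     = # 2 ∷ # 7 ∷ # 6 ∷ # 5 ∷ # 8 ∷ # 0 ∷ []
  ; path₂     = # 0 ∷ # 4 ∷ # 5 ∷ # 3 ∷ # 7 ∷ # 1 ∷ []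
  }

baseHandleCertificate : PatchCertificate 6 1
baseHandleCertificate = record
  { mark₁     = # 1 ; mark₂ = # 5 ; mark₃ = # 4
  ; faces₀    = (# 4 , # 7 , # 1) ∷ (# 5 , # 1 , # 8) ∷ (# 1 , # 3 , # 8) ∷ (# 8 , # 2 , # 0) ∷ (# 4 , # 2 , # 8) ∷ (# 5 , # 8 , # 0) ∷
                 (# 7 , # 4 , # 8) ∷ (# 6 , # 2 , # 4) ∷ (# 6 , # 7 , # 8) ∷ (# 8 , # 3 , # 6) ∷ (# 2 , # 6 , # 3) ∷ (# 3 , # 1 , # 2) ∷
                 (# 0 , # 6 , # 4) ∷ (# 4 , # 5 , # 0) ∷ (# 6 , # 0 , # 1) ∷ (# 1 , # 7 , # 6) ∷ []
  ; parent    = lookup (# 0 ∷ # 8 ∷ # 8 ∷ # 8 ∷ # 0 ∷ # 0 ∷ # 0 ∷ # 8 ∷ # 0 ∷ [])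
  ; depth     = lookup (0 ∷ 2 ∷ 2 ∷ 2 ∷ 1 ∷ 1 ∷ 1 ∷ 2 ∷ 1 ∷ [])
  ; neighbour = lookup (# 8 ∷ # 1 ∷ # 4 ∷ # 2 ∷ # 1 ∷ # 5 ∷ [])
  ; link      = lookup ((# 8 ∷ # 1 ∷ # 2 ∷ # 6 ∷ [])
                 ∷ (# 1 ∷ # 5 ∷ # 0 ∷ # 6 ∷ # 2 ∷ # 8 ∷ # 7 ∷ [])
                 ∷ (# 4 ∷ # 1 ∷ # 8 ∷ # 0 ∷ [])
                 ∷ (# 2 ∷ # 4 ∷ # 0 ∷ # 1 ∷ # 7 ∷ # 8 ∷ # 3 ∷ [])
                 ∷ (# 1 ∷ # 4 ∷ # 8 ∷ # 6 ∷ [])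
                 ∷ (# 5 ∷ # 1 ∷ # 3 ∷ # 6 ∷ # 7 ∷ # 4 ∷ # 2 ∷ # 0 ∷ [])
                 ∷ [])
  ; path₀     = # 1 ∷ # 6 ∷ # 4 ∷ # 5 ∷ # 8 ∷ # 2 ∷ []
  ; path₁     = # 2 ∷ # 3 ∷ # 8 ∷ # 5 ∷ # 4 ∷ # 7 ∷ # 6 ∷ # 0 ∷ []
  ; path₂     = # 0 ∷ # 8 ∷ # 4 ∷ # 6 ∷ # 3 ∷ # 1 ∷ []
  }

stellar : ColouredPatch 1 0
stellar = record
  { patch        = P
  ; κ            = λ _ → true
  ; proper       = from-yes (Proper? (colourPatch (λ _ → true)) (Patch.faces P))
  ; mark₃-colour = refl
  ; mark₂-colour = refl
  ; rigid        = from-yes (rigid? (Patch.faces₀ P) (λ _ → true))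
  }
  where
  P : Patch 1 0
  P = CertifiedPatch.patch stellarCertificate (from-yes (CertifiedPatch.checks? stellarCertificate))

handle : ColouredPatch 6 1
handle = record
  { patch        = P
  ; κ            = κ
  ; proper       = from-yes (Proper? (colourPatch κ) (Patch.faces P))
  ; mark₃-colour = refl
  ; mark₂-colour = refl
  ; rigid        = from-yes (rigid? (Patch.faces₀ P) κ)
  }
  where
  P : Patch 6 1
  P = CertifiedPatch.patch handleCertificate (from-yes (CertifiedPatch.checks? handleCertificate))
  κ : Fin 6 → Bool
  κ = lookup (true ∷ true ∷ false ∷ false ∷ false ∷ true ∷ [])

baseHandle : Patch 6 1
baseHandle = CertifiedPatch.patch baseHandleCertificate (from-yes (CertifiedPatch.checks? baseHandleCertificate))

tetrahedron₀ : List (Triple 4)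
tetrahedron₀ = (# 1 , # 0 , # 3) ∷ (# 2 , # 1 , # 3) ∷ (# 0 , # 2 , # 3) ∷ []

tetrahedron-isTriangulation : IsTriangulation ((# 0 , # 1 , # 2) ∷ tetrahedron₀) 0
tetrahedron-isTriangulation = isTriangulation (from-yes checks?)
  where
  open CertifiedTriangulation ((# 0 , # 1 , # 2) ∷ tetrahedron₀) 0 (# 0) (λ _ → # 0) (lookup (0 ∷ 1 ∷ 1 ∷ 1 ∷ []))
         (lookup (# 1 ∷ # 2 ∷ # 0 ∷ # 1 ∷ []))
         (lookup ((# 1 ∷ # 2 ∷ # 3 ∷ []) ∷ (# 2 ∷ # 0 ∷ # 3 ∷ []) ∷ (# 0 ∷ # 1 ∷ # 3 ∷ []) ∷ (# 1 ∷ # 0 ∷ # 2 ∷ []) ∷ []))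

record RigidTriangulation (m g : ℕ) : Set where
  field
    a b c           : Fin m
    rest            : List (Triple m)
    isTriangulation : IsTriangulation ((a , b , c) ∷ rest) g
    rigidColouring  : RigidColouring a b c rest

glue : ∀ {k h m g} → ColouredPatch k h → RigidTriangulation m g → RigidTriangulation (m + k) (g + h)
glue P T = record
  { a               = embed mark₁
  ; b               = embed mark₂
  ; c               = embed mark₃
  ; rest            = gluedTail
  ; isTriangulation = glued-isTriangulation isTriangulation
  ; rigidColouring  = glued-rigidColouring P a b c rest rigidColouring
  }
  where
  open RigidTriangulation T
  open ColouredPatch P using (patch)
  open Patch patch using (mark₁; mark₂; mark₃)
  open Glue patch a b c rest

-- The tetrahedron alone has three proper colourings up to flipping; gluing the base handle
-- into one of its faces leaves a single one, found by search over all 2¹⁰ states.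
torus : RigidTriangulation 10 1
torus = record
  { a               = embed mark₁
  ; b               = embed mark₂
  ; c               = embed mark₃
  ; rest            = gluedTail
  ; isTriangulation = glued-isTriangulation tetrahedron-isTriangulation
  ; rigidColouring  = record
    { colouring = alternating
    ; colour-c  = refl
    ; colour-b  = refl
    ; proper    = from-yes (Proper? alternating gluedTail)
    ; unique    = from-yes (unique? alternating gluedTail)
    }
  }
  where
  open Patch baseHandle using (mark₁; mark₂; mark₃)
  open Glue baseHandle (# 0) (# 1) (# 2) tetrahedron₀
  alternating : State 10
  alternating = lookup (true ∷ false ∷ true ∷ false ∷ true ∷ false ∷ true ∷ false ∷ true ∷ false ∷ [])

rigidTriangulation-ofGenus : ∀ i → Σ ℕ λ m → RigidTriangulation m (suc i)
rigidTriangulation-ofGenus zero    = 10 , torus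
rigidTriangulation-ofGenus (suc i) with rigidTriangulation-ofGenus i
... | m , T = m + 6 , subst (RigidTriangulation (m + 6)) (ℕP.+-comm (suc i) 1) (glue handle T)

rigidTriangulation-≥ : ∀ t {m g} → RigidTriangulation m g → Σ ℕ λ m′ → t ≤ m′ × RigidTriangulation m′ g
rigidTriangulation-≥ zero            T = _ , z≤n , T
rigidTriangulation-≥ (suc t) {g = g} T with rigidTriangulation-≥ t T
... | m′ , t≤m′ , T′ = m′ + 1 , subst (suc t ≤_) (ℕP.+-comm 1 m′) (s≤s t≤m′) ,
                       subst (RigidTriangulation (m′ + 1)) (ℕP.+-identityʳ g) (glue stellar T′)

theorem1 : ∀ (g : ℕ) → 0 < g → ∀ (n : ℕ) → 0 < n →
    Σ ℕ λ m → (n ≤ m) × Σ (List (Triple m)) λ F → IsTriangulation F g × NonDegenerate F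
theorem1 (suc i) _ n _ with rigidTriangulation-ofGenus i
... | _ , T with rigidTriangulation-≥ n T
... | m , n≤m , T′ = m , n≤m , _ , isTriangulation ,
      UniqueProperColouring⇒NonDegenerate isTriangulation (RigidColouring⇒UniqueProperColouring rigidColouring)
  where open RigidTriangulation T′
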